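{- Let $d$ be a positive integer and let $a_1,a_2,b_1,b_2$ be integers with $0<a_1<b_1\le d$ and $0<a_2<b_2\le d$, such that $a_1\leq a_2$ and $b_1\leq b_2$, and not both $a_1=a_2$ and $b_1=b_2$. Then $$\lim_{n\to\infty}\left(\ell_d^{(a_1,b_1)}(n)-\ell_d^{(a_2,b_2)}(n)\right)=+\infty,$$ and moreover $\ell_d^{(a_1,b_1)}(n)\geq \ell_d^{(a_2,b_2)}(n)$ for all $n\geq 1$. Here, for $0<a<b\le d$, $\ell_d^{(a,b)}(n)$ denotes the number of partitions of perimeter $n$ all of whose parts are congruent to $a$ or to $b$ modulo $d$.
   Context: A partition is a finite nonincreasing sequence of positive integers (its parts); partitions of any size are allowed. For a partition $\pi$ with largest part $\alpha(\pi)$ and number of parts $\lambda(\pi)$, its perimeter is $\alpha(\pi)+\lambda(\pi)-1$. A part congruent to $d$ modulo $d$ means a part divisible by $d$. -}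

module Defs where

open import Data.Nat using (ℕ; zero; suc; _+_; _≤_; _≥_; _⊔_; NonZero)
open import Data.Nat.Properties using (_≟_; _≤?_)
open import Data.Nat.DivMod using (_%_)
open import Data.List using (List; []; _∷_; [_]; map; concatMap; upTo; length; filter; foldr)
open import Data.List.Relation.Unary.All using (All; all?)
open import Data.List.Relation.Unary.Linked using (Linked; linked?)
open import Data.Product using (_×_)
open import Data.Sum using (_⊎_)
open import Relation.Nullary using (Dec)
open import Relation.Nullary.Decidable using (_×-dec_; _⊎-dec_)
open import Relation.Binary.PropositionalEquality using (_≡_)

-- A partition is represented as a list of its parts (nonincreasing, positive).

largest : List ℕ → ℕ
largest = foldr _⊔_ 0

_≡_[mod_] : ℕ → ℕ → (d : ℕ) → .{{NonZero d}} → Set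
x ≡ c [mod d ] = x % d ≡ c % d

-- π is a partition (nonincreasing, positive parts), all of whose parts are
-- congruent to a or b modulo d, and with perimeter α(π)+λ(π)-1 = n
-- (stated as α(π)+λ(π) = n+1, which also excludes the empty partition).
IsCounted : (d : ℕ) → .{{NonZero d}} → (a b n : ℕ) → List ℕ → Set
IsCounted d a b n π =
  Linked _≥_ π
  × All (λ x → 1 ≤ x) π
  × All (λ x → (x ≡ a [mod d ]) ⊎ (x ≡ b [mod d ])) π
  × (largest π + length π ≡ suc n)

isCounted? : (d : ℕ) → .{{_ : NonZero d}} → (a b n : ℕ) → (π : List ℕ) → Dec (IsCounted d a b n π)
isCounted? d a b n π =
  linked? (λ x y → y ≤? x) π
  ×-dec all? (λ x → 1 ≤? x) π
  ×-dec all? (λ x → ((x % d) ≟ (a % d)) ⊎-dec ((x % d) ≟ (b % d))) π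
  ×-dec ((largest π + length π) ≟ suc n)

listsOfLength : ℕ → ℕ → List (List ℕ)
listsOfLength m zero    = [ [] ]
listsOfLength m (suc k) =
  concatMap (λ x → map (x ∷_) (listsOfLength m k)) (map suc (upTo m))

-- all lists of length ≤ n with entries in {1,…,n}; every partition of
-- perimeter n has largest part ≤ n and at most n parts, so it occurs here
-- exactly once.
candidates : ℕ → List (List ℕ)
candidates n = concatMap (listsOfLength n) (upTo (suc n))

ℓ : (d : ℕ) → .{{NonZero d}} → (a b n : ℕ) → ℕ
ℓ d a b n = length (filter (isCounted? d a b n) (candidates n))

{-# OPTIONS --safe #-}
module Submission where

-- The parts allowed for residues 0 < a < b ≤ d are the numbers a + kd and b + kd, and how two
-- of them compare depends only on their classes and indices k, not on (a, b). So replacing every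
-- part a₂ + kd, b₂ + kd of a partition by a₁ + kd, b₁ + kd keeps it sorted; the largest part drops
-- by its shift a₂ − a₁ or b₂ − b₁, and appending that many parts a₁ restores the perimeter. This
-- injects the (a₂, b₂)-partitions of perimeter n into the (a₁, b₁)-partitions of perimeter n.
-- If the class c has positive shift and residue c₁ for (a₁, b₁), no partition
-- (c₁ + (j + 1) d, b₁, …, b₁) is in the image: an image whose largest part lies in class c ends
-- with an appended a₁ ≠ b₁. There are M of these once n ≥ c₁ + M d.

open import Defs
open import Data.Nat using (ℕ; zero; suc; _+_; _*_; _∸_; _⊔_; _≤_; _<_; _≥_; s≤s; s≤s⁻¹; z<s; NonZero)
open import Data.Nat.Properties
open import Data.Nat.DivMod using (_%_; _/_; m≡m%n+[m/n]*n; [m+kn]%n≡m%n; n%n≡0; m<n⇒m%n≡m)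
open import Data.Nat.Tactic.RingSolver using (solve-∀)
import Data.Fin as Fin
open import Data.Fin.Properties using (injective⇒≤)
open import Data.List
  using (List; []; _∷_; map; concatMap; length; lookup; filter; upTo; replicate; applyUpTo; _++_)
open import Data.List.Properties
  using (∷-injectiveˡ; ∷-injectiveʳ; ++-cancelʳ; length-++; length-map; length-replicate; length-applyUpTo)
open import Data.List.Relation.Unary.All as All using (All; []; _∷_)
import Data.List.Relation.Unary.All.Properties as All
open import Data.List.Relation.Unary.Any using (here; there)
open import Data.List.Relation.Unary.Linked using (Linked; [-]; _∷_)
open import Data.List.Relation.Unary.AllPairs using ([]; _∷_)
open import Data.List.Relation.Unary.Unique.Propositional using (Unique)
import Data.List.Relation.Unary.Unique.Propositional.Properties as Unique
open import Data.List.Relation.Binary.Disjoint.Propositional using (Disjoint)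
open import Data.List.Relation.Binary.Subset.Propositional using (_⊆_)
open import Data.List.Membership.Propositional using (_∈_; _∉_; find; lose)
open import Data.List.Membership.Propositional.Properties
open import Data.List.Membership.Setoid.Properties using (index-injective)
open import Data.Product using (_×_; _,_; ∃; proj₂; uncurry)
open import Data.Sum using (_⊎_; inj₁; inj₂)
open import Relation.Nullary using (¬_; yes; no; contradiction)
open import Relation.Unary using (Decidable)
open import Function using (_∘_)
open import Relation.Binary.PropositionalEquality

module _ {A : Set} where

  Unique⇒lookup-injective : ∀ {xs : List A} → Unique xs → ∀ {i j} → lookup xs i ≡ lookup xs j → i ≡ j
  Unique⇒lookup-injective (_ ∷ _) {Fin.zero} {Fin.zero} _ = refl
  Unique⇒lookup-injective (x∉xs ∷ _) {Fin.zero} {Fin.suc j} eq =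
    contradiction eq (All.lookup x∉xs (∈-lookup j))
  Unique⇒lookup-injective (x∉xs ∷ _) {Fin.suc i} {Fin.zero} eq =
    contradiction (sym eq) (All.lookup x∉xs (∈-lookup i))
  Unique⇒lookup-injective (_ ∷ u) {Fin.suc i} {Fin.suc j} eq =
    cong Fin.suc (Unique⇒lookup-injective u eq)

  Unique-⊆⇒length≤ : ∀ {xs ys : List A} → Unique xs → xs ⊆ ys → length xs ≤ length ys
  Unique-⊆⇒length≤ u xs⊆ys = injective⇒≤ λ {i} {j} eq →
    Unique⇒lookup-injective u (index-injective (setoid A) (xs⊆ys (∈-lookup i)) (xs⊆ys (∈-lookup j)) eq)

  ∈-replicate⁺ : ∀ {m} {w : A} → 0 < m → w ∈ replicate m w
  ∈-replicate⁺ {suc _} _ = here refl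

  ∈-replicate⁻ : ∀ {m} {v w : A} → v ∈ replicate m w → v ≡ w
  ∈-replicate⁻ {suc _} (here v≡w) = v≡w
  ∈-replicate⁻ {suc _} (there v∈) = ∈-replicate⁻ v∈

module _ {A B : Set} where

  Unique-map⁺-on : (F : A → B) → ∀ {xs} → (∀ {x x′} → x ∈ xs → x′ ∈ xs → F x ≡ F x′ → x ≡ x′)
    → Unique xs → Unique (map F xs)
  Unique-map⁺-on F {[]} _ [] = []
  Unique-map⁺-on F {x ∷ xs} injective (x∉xs ∷ u) =
    All.map⁺ (All.tabulate λ x′∈ → All.lookup x∉xs x′∈ ∘ injective (here refl) (there x′∈))
    ∷ Unique-map⁺-on F (λ p q → injective (there p) (there q)) u

  Unique-concatMap⁺ : (f : A → List B) (h : B → A) → (∀ {x y} → y ∈ f x → h y ≡ x)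
    → ∀ {xs} → Unique xs → (∀ x → Unique (f x)) → Unique (concatMap f xs)
  Unique-concatMap⁺ f h h-inverts {[]} _ _ = []
  Unique-concatMap⁺ f h h-inverts {x ∷ xs} (x∉xs ∷ u) uf =
    Unique.++⁺ (uf x) (Unique-concatMap⁺ f h h-inverts u uf) disjoint
    where
    disjoint : Disjoint (f x) (concatMap f xs)
    disjoint (y∈fx , y∈rest) with find (∈-concatMap⁻ f {xs = xs} y∈rest)
    ... | x′ , x′∈xs , y∈fx′ = All.lookup x∉xs x′∈xs (trans (sym (h-inverts y∈fx)) (h-inverts y∈fx′))

  length-filter-+-≤ : ∀ {P : A → Set} {Q : B → Set} (P? : Decidable P) (Q? : Decidable Q)
    {C : List A} {D E : List B} (F : A → B)
    → Unique C → Unique E → (∀ {y} → Q y → y ∈ D)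
    → (∀ {x} → P x → Q (F x)) → (∀ {x x′} → P x → P x′ → F x ≡ F x′ → x ≡ x′)
    → All Q E → (∀ {x} → P x → F x ∉ E)
    → length (filter P? C) + length E ≤ length (filter Q? D)
  length-filter-+-≤ {P} P? Q? {C} {D} {E} F uC uE Q⊆D F-maps F-injective QE F∉E = begin
    length (filter P? C) + length E                ≡⟨ cong (_+ length E) (length-map F (filter P? C)) ⟨
    length (map F (filter P? C)) + length E        ≡⟨ length-++ (map F (filter P? C)) ⟨
    length (map F (filter P? C) ++ E)              ≤⟨ Unique-⊆⇒length≤ unique image⊆ ⟩
    length (filter Q? D)                           ∎
    where
    open ≤-Reasoning
    P-of : ∀ {x} → x ∈ filter P? C → P x
    P-of x∈ = proj₂ (∈-filter⁻ P? {xs = C} x∈)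
    image∉E : Disjoint (map F (filter P? C)) E
    image∉E (y∈image , y∈E) with ∈-map⁻ F y∈image
    ... | x , x∈ , refl = F∉E (P-of x∈) y∈E
    unique : Unique (map F (filter P? C) ++ E)
    unique = Unique.++⁺
      (Unique-map⁺-on F (λ p q → F-injective (P-of p) (P-of q)) (Unique.filter⁺ P? uC)) uE image∉E
    image⊆ : map F (filter P? C) ++ E ⊆ filter Q? D
    image⊆ y∈ with ∈-++⁻ (map F (filter P? C)) y∈
    ... | inj₂ y∈E = ∈-filter⁺ Q? (Q⊆D (All.lookup QE y∈E)) (All.lookup QE y∈E)
    ... | inj₁ y∈image with ∈-map⁻ F y∈image
    ...   | x , x∈ , refl = ∈-filter⁺ Q? (Q⊆D (F-maps (P-of x∈))) (F-maps (P-of x∈))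

linked-replicate : ∀ {w y} k → w ≤ y → Linked _≥_ (y ∷ replicate k w)
linked-replicate zero    _   = [-]
linked-replicate (suc k) w≤y = w≤y ∷ linked-replicate k ≤-refl

≤-largest : ∀ {x π} → x ∈ π → x ≤ largest π
≤-largest {π = y ∷ ys} (here refl) = m≤m⊔n y (largest ys)
≤-largest {π = y ∷ ys} (there x∈ys) = ≤-trans (≤-largest x∈ys) (m≤n⊔m y (largest ys))

largest-linked : ∀ {x xs} → Linked _≥_ (x ∷ xs) → largest (x ∷ xs) ≡ x
largest-linked {x} [-] = ⊔-identityʳ x
largest-linked {x} (y≤x ∷ lk) = trans (cong (x ⊔_) (largest-linked lk)) (m≥n⇒m⊔n≡m y≤x)

length-∈-listsOfLength : ∀ m k {π} → π ∈ listsOfLength m k → length π ≡ k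
length-∈-listsOfLength m zero (here refl) = refl
length-∈-listsOfLength m (suc k) π∈
  with find (∈-concatMap⁻ (λ x → map (x ∷_) (listsOfLength m k)) {xs = map suc (upTo m)} π∈)
... | x , _ , π∈x∷ with ∈-map⁻ (x ∷_) π∈x∷
...   | _ , π′∈ , refl = cong suc (length-∈-listsOfLength m k π′∈)

listsOfLength-unique : ∀ m k → Unique (listsOfLength m k)
listsOfLength-unique m zero = [] ∷ []
listsOfLength-unique m (suc k) =
  Unique-concatMap⁺ (λ x → map (x ∷_) (listsOfLength m k)) head head-∈
    (Unique.map⁺ suc-injective (Unique.upTo⁺ m))
    (λ _ → Unique.map⁺ ∷-injectiveʳ (listsOfLength-unique m k))
  where
  head : List ℕ → ℕ
  head []      = 0
  head (x ∷ _) = x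
  head-∈ : ∀ {x π} → π ∈ map (x ∷_) (listsOfLength m k) → head π ≡ x
  head-∈ {x} π∈ with ∈-map⁻ (x ∷_) π∈
  ... | _ , _ , refl = refl

candidates-unique : ∀ n → Unique (candidates n)
candidates-unique n =
  Unique-concatMap⁺ (listsOfLength n) length (length-∈-listsOfLength n _)
    (Unique.upTo⁺ (suc n)) (listsOfLength-unique n)

∈-listsOfLength : ∀ m {π} → All (1 ≤_) π → All (_≤ m) π → π ∈ listsOfLength m (length π)
∈-listsOfLength m [] [] = here refl
∈-listsOfLength m {suc x ∷ π} (_ ∷ pos) (x<m ∷ ≤m) =
  ∈-concatMap⁺ (λ y → map (y ∷_) (listsOfLength m (length π)))
    (lose (∈-map⁺ suc (∈-upTo⁺ x<m)) (∈-map⁺ (suc x ∷_) (∈-listsOfLength m pos ≤m)))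

counted⇒∈candidates : ∀ {d} .{{_ : NonZero d}} {a b n π} → IsCounted d a b n π → π ∈ candidates n
counted⇒∈candidates {n = n} {x ∷ xs} (_ , pos@(1≤x ∷ _) , _ , perimeter) =
  ∈-concatMap⁺ (listsOfLength n)
    (lose (∈-upTo⁺ (s≤s length≤n)) (∈-listsOfLength n pos parts≤n))
  where
  largest≤n : largest (x ∷ xs) ≤ n
  largest≤n = s≤s⁻¹ (subst (largest (x ∷ xs) <_) perimeter (m<m+n _ z<s))
  parts≤n : All (_≤ n) (x ∷ xs)
  parts≤n = All.tabulate λ y∈ → ≤-trans (≤-largest y∈) largest≤n
  1≤largest : 1 ≤ largest (x ∷ xs)
  1≤largest = ≤-trans 1≤x (≤-largest {π = x ∷ xs} (here refl))
  length≤n : length (x ∷ xs) ≤ n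
  length≤n = s≤s⁻¹ (subst (length (x ∷ xs) <_) perimeter (m<n+m _ 1≤largest))

module Residues (d : ℕ) .{{_ : NonZero d}} where

  InClass : ℕ → ℕ → ℕ → Set
  InClass a b x = (x ≡ a [mod d ]) ⊎ (x ≡ b [mod d ])

  record Admissible (a b : ℕ) : Set where
    constructor admissible
    field
      0<a : 0 < a
      a<b : a < b
      b≤d : b ≤ d

  data Class : Set where
    α β : Class

  base : ℕ → ℕ → Class → ℕ
  base a b α = a
  base a b β = b

  part : ℕ → ℕ → Class → ℕ → ℕ
  part a b c k = base a b c + k * d

  -- Only meaningful on allowed parts: anything not congruent to a is sent to β.
  classOf : ℕ → ℕ → Class
  classOf a x with x % d ≟ a % d
  ... | yes _ = α
  ... | no _  = β

  data Allowed (a b : ℕ) : ℕ → Set where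
    allowed : ∀ c k → Allowed a b (part a b c k)

  base-allowed : ∀ {a b} c → Allowed a b (base a b c)
  base-allowed {a} {b} c = subst (Allowed a b) (+-identityʳ (base a b c)) (allowed c 0)

  part-% : ∀ a b c k → part a b c k % d ≡ base a b c % d
  part-% a b c k = [m+kn]%n≡m%n (base a b c) k d

  -- The case r = d needs 1 ≤ x, since then x % d ≡ 0 and x = d + k d.
  ≡[mod]⇒≡+* : ∀ {x r} → r ≤ d → 1 ≤ x → x ≡ r [mod d ] → ∃ λ k → x ≡ r + k * d
  ≡[mod]⇒≡+* {x} r≤d 1≤x x≡r with m≤n⇒m<n∨m≡n r≤d
  ... | inj₁ r<d = x / d , trans (m≡m%n+[m/n]*n x d) (cong (_+ x / d * d) (trans x≡r (m<n⇒m%n≡m r<d)))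
  ... | inj₂ refl with x / d | m≡m%n+[m/n]*n x d
  ...   | zero  | x≡ = contradiction (trans x≡ (cong (_+ 0) (trans x≡r (n%n≡0 d)))) (≢-sym (<⇒≢ 1≤x))
  ...   | suc k | x≡ = k , trans x≡ (cong (_+ suc k * d) (trans x≡r (n%n≡0 d)))

  module _ {a b : ℕ} (adm : Admissible a b) where

    open Admissible adm

    decompose : ∀ {x} → 1 ≤ x → InClass a b x → Allowed a b x
    decompose 1≤x (inj₁ x≡a) with ≡[mod]⇒≡+* (<⇒≤ (<-≤-trans a<b b≤d)) 1≤x x≡a
    ... | k , refl = allowed α k
    decompose 1≤x (inj₂ x≡b) with ≡[mod]⇒≡+* b≤d 1≤x x≡b
    ... | k , refl = allowed β k

    a≤base : ∀ c → a ≤ base a b c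
    a≤base α = ≤-refl
    a≤base β = <⇒≤ a<b

    base≤d : ∀ c → base a b c ≤ d
    base≤d α = <⇒≤ (<-≤-trans a<b b≤d)
    base≤d β = b≤d

    a≤allowed : ∀ {x} → Allowed a b x → a ≤ x
    a≤allowed (allowed c k) = ≤-trans (a≤base c) (m≤m+n (base a b c) (k * d))

    allowed-positive : ∀ {x} → Allowed a b x → 1 ≤ x
    allowed-positive px = ≤-trans 0<a (a≤allowed px)

    allowed-InClass : ∀ {x} → Allowed a b x → InClass a b x
    allowed-InClass (allowed α k) = inj₁ (part-% a b α k)
    allowed-InClass (allowed β k) = inj₂ (part-% a b β k)

    counted⇒allowed : ∀ {n π} → IsCounted d a b n π → All (Allowed a b) π
    counted⇒allowed (_ , pos , cls , _) = All.zipWith (uncurry decompose) (pos , cls)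

    allowed⇒counted : ∀ {n π} → Linked _≥_ π → All (Allowed a b) π → largest π + length π ≡ suc n
      → IsCounted d a b n π
    allowed⇒counted sorted allowedParts perimeter =
      sorted , All.map allowed-positive allowedParts , All.map allowed-InClass allowedParts , perimeter

    a%d≢b%d : a % d ≢ b % d
    a%d≢b%d eq with m≤n⇒m<n∨m≡n b≤d
    ... | inj₁ b<d = <⇒≢ a<b (trans (sym (m<n⇒m%n≡m (<-trans a<b b<d))) (trans eq (m<n⇒m%n≡m b<d)))
    ... | inj₂ refl = <⇒≢ 0<a (sym (trans (sym (m<n⇒m%n≡m a<b)) (trans eq (n%n≡0 d))))

    base-%-injective : ∀ {c c′} → base a b c % d ≡ base a b c′ % d → c ≡ c′
    base-%-injective {α} {α} _ = refl
    base-%-injective {β} {β} _ = refl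
    base-%-injective {α} {β} eq = contradiction eq a%d≢b%d
    base-%-injective {β} {α} eq = contradiction (sym eq) a%d≢b%d

    part-injective : ∀ {c c′ k k′} → part a b c k ≡ part a b c′ k′ → c ≡ c′ × k ≡ k′
    part-injective {c} {c′} {k} {k′} eq
      with base-%-injective (trans (sym (part-% a b c k)) (trans (cong (_% d) eq) (part-% a b c′ k′)))
    ... | refl = refl , *-cancelʳ-≡ k k′ d (+-cancelˡ-≡ (base a b c) _ _ eq)

    classOf-part : ∀ c k → classOf a (part a b c k) ≡ c
    classOf-part c k with part a b c k % d ≟ a % d
    classOf-part c     k | yes eq = sym (base-%-injective (trans (sym (part-% a b c k)) eq))
    classOf-part α     k | no ≢a  = contradiction (part-% a b α k) ≢a
    classOf-part β     k | no _   = refl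

    part-≤⇒index-≤ : ∀ {c c′ k k′} → part a b c k ≤ part a b c′ k′ → k ≤ k′
    part-≤⇒index-≤ {c} {c′} {k} {k′} le = s≤s⁻¹ (*-cancelʳ-< d k (suc k′) (begin-strict
      k * d              <⟨ m<n+m (k * d) (≤-trans 0<a (a≤base c)) ⟩
      part a b c k       ≤⟨ le ⟩
      part a b c′ k′     ≤⟨ +-monoˡ-≤ (k′ * d) (base≤d c′) ⟩
      suc k′ * d         ∎))
      where open ≤-Reasoning

    part-β≤part-α⇒index-< : ∀ {k k′} → part a b β k ≤ part a b α k′ → k < k′
    part-β≤part-α⇒index-< {k} {k′} le = *-cancelʳ-< d k k′ (+-cancelˡ-< a (k * d) (k′ * d) (begin-strict
      a + k * d          <⟨ +-monoˡ-< (k * d) a<b ⟩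
      b + k * d          ≤⟨ le ⟩
      a + k′ * d         ∎))
      where open ≤-Reasoning

  part-≤-transfer : ∀ {a b a′ b′} c c′ {k k′} → Admissible a b → Admissible a′ b′
    → part a b c k ≤ part a b c′ k′ → part a′ b′ c k ≤ part a′ b′ c′ k′
  part-≤-transfer {a′ = a′} α α {k} {k′} adm _ le =
    +-monoʳ-≤ a′ (*-monoˡ-≤ d (part-≤⇒index-≤ adm {α} {α} {k} {k′} le))
  part-≤-transfer {b′ = b′} β β {k} {k′} adm _ le =
    +-monoʳ-≤ b′ (*-monoˡ-≤ d (part-≤⇒index-≤ adm {β} {β} {k} {k′} le))
  part-≤-transfer α β {k} {k′} adm adm′ le =
    +-mono-≤ (<⇒≤ (Admissible.a<b adm′)) (*-monoˡ-≤ d (part-≤⇒index-≤ adm {α} {β} {k} {k′} le))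
  part-≤-transfer {a′ = a′} {b′} β α {k} {k′} adm adm′ le = begin
    b′ + k * d        ≤⟨ +-monoˡ-≤ (k * d) (Admissible.b≤d adm′) ⟩
    suc k * d         ≤⟨ *-monoˡ-≤ d (part-β≤part-α⇒index-< adm {k} {k′} le) ⟩
    k′ * d            ≤⟨ m≤n+m (k′ * d) a′ ⟩
    a′ + k′ * d       ∎
    where open ≤-Reasoning

module Shrink (d : ℕ) .{{_ : NonZero d}} {a₁ b₁ a₂ b₂ : ℕ}
  (adm₁ : Residues.Admissible d a₁ b₁) (adm₂ : Residues.Admissible d a₂ b₂)
  (a₁≤a₂ : a₁ ≤ a₂) (b₁≤b₂ : b₁ ≤ b₂) where

  open Residues d

  shift : Class → ℕ
  shift α = a₂ ∸ a₁
  shift β = b₂ ∸ b₁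

  part-+-shift : ∀ c k → part a₁ b₁ c k + shift c ≡ part a₂ b₂ c k
  part-+-shift c k = begin
    base a₁ b₁ c + k * d + shift c     ≡⟨ +-assoc (base a₁ b₁ c) (k * d) (shift c) ⟩
    base a₁ b₁ c + (k * d + shift c)   ≡⟨ cong (base a₁ b₁ c +_) (+-comm (k * d) (shift c)) ⟩
    base a₁ b₁ c + (shift c + k * d)   ≡⟨ +-assoc (base a₁ b₁ c) (shift c) (k * d) ⟨
    base a₁ b₁ c + shift c + k * d     ≡⟨ cong (_+ k * d) (base-+-shift c) ⟩
    base a₂ b₂ c + k * d               ∎
    where
    open ≡-Reasoning
    base-+-shift : ∀ c → base a₁ b₁ c + shift c ≡ base a₂ b₂ c
    base-+-shift α = m+[n∸m]≡n a₁≤a₂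
    base-+-shift β = m+[n∸m]≡n b₁≤b₂

  δ : ℕ → ℕ
  δ x = shift (classOf a₂ x)

  φ : ℕ → ℕ
  φ x = x ∸ δ x

  δ-part : ∀ c k → δ (part a₂ b₂ c k) ≡ shift c
  δ-part c k = cong shift (classOf-part adm₂ c k)

  φ-part : ∀ c k → φ (part a₂ b₂ c k) ≡ part a₁ b₁ c k
  φ-part c k = begin
    part a₂ b₂ c k ∸ δ (part a₂ b₂ c k)    ≡⟨ cong (part a₂ b₂ c k ∸_) (δ-part c k) ⟩
    part a₂ b₂ c k ∸ shift c               ≡⟨ cong (_∸ shift c) (part-+-shift c k) ⟨
    part a₁ b₁ c k + shift c ∸ shift c     ≡⟨ m+n∸n≡m (part a₁ b₁ c k) (shift c) ⟩
    part a₁ b₁ c k                         ∎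
    where open ≡-Reasoning

  φ-allowed : ∀ {x} → Allowed a₂ b₂ x → Allowed a₁ b₁ (φ x)
  φ-allowed (allowed c k) = subst (Allowed a₁ b₁) (sym (φ-part c k)) (allowed c k)

  φ-+-δ : ∀ {x} → Allowed a₂ b₂ x → φ x + δ x ≡ x
  φ-+-δ (allowed c k) = trans (cong₂ _+_ (φ-part c k) (δ-part c k)) (part-+-shift c k)

  φ-injective : ∀ {x y} → Allowed a₂ b₂ x → Allowed a₂ b₂ y → φ x ≡ φ y → x ≡ y
  φ-injective (allowed c k) (allowed c′ k′) eq
    with part-injective adm₁ {c} {c′} {k} {k′} (trans (sym (φ-part c k)) (trans eq (φ-part c′ k′)))
  ... | refl , refl = refl

  φ-monotone : ∀ {x y} → Allowed a₂ b₂ x → Allowed a₂ b₂ y → y ≤ x → φ y ≤ φ x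
  φ-monotone (allowed c k) (allowed c′ k′) y≤x
    rewrite φ-part c k | φ-part c′ k′ = part-≤-transfer c′ c {k′} {k} adm₂ adm₁ y≤x

  map-φ-injective : ∀ {xs ys} → All (Allowed a₂ b₂) xs → All (Allowed a₂ b₂) ys
    → map φ xs ≡ map φ ys → xs ≡ ys
  map-φ-injective [] [] _ = refl
  map-φ-injective (px ∷ pxs) (py ∷ pys) eq =
    cong₂ _∷_ (φ-injective px py (∷-injectiveˡ eq)) (map-φ-injective pxs pys (∷-injectiveʳ eq))

  shrink : List ℕ → List ℕ
  shrink []       = []
  shrink (x ∷ xs) = φ x ∷ map φ xs ++ replicate (δ x) a₁

  padded-linked : ∀ {x xs} → All (Allowed a₂ b₂) (x ∷ xs) → Linked _≥_ (x ∷ xs)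
    → ∀ k → Linked _≥_ (φ x ∷ map φ xs ++ replicate k a₁)
  padded-linked (px ∷ []) [-] k = linked-replicate k (a≤allowed adm₁ (φ-allowed px))
  padded-linked (px ∷ pxs@(py ∷ _)) (y≤x ∷ sorted) k = φ-monotone px py y≤x ∷ padded-linked pxs sorted k

  shrink-allowed : ∀ {π} → All (Allowed a₂ b₂) π → All (Allowed a₁ b₁) (shrink π)
  shrink-allowed [] = []
  shrink-allowed (px ∷ pxs) =
    φ-allowed px ∷ All.++⁺ (All.map⁺ (All.map φ-allowed pxs)) (All.replicate⁺ _ (base-allowed α))

  shrink-perimeter : ∀ {x xs} → All (Allowed a₂ b₂) (x ∷ xs) → Linked _≥_ (x ∷ xs)
    → largest (shrink (x ∷ xs)) + length (shrink (x ∷ xs)) ≡ largest (x ∷ xs) + length (x ∷ xs)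
  shrink-perimeter {x} {xs} pxs@(px ∷ _) sorted = begin
    largest (shrink (x ∷ xs)) + length (shrink (x ∷ xs))
      ≡⟨ cong₂ _+_ (largest-linked (padded-linked pxs sorted (δ x))) (cong suc length-padded) ⟩
    φ x + suc (length xs + δ x)     ≡⟨ rearrange (φ x) (length xs) (δ x) ⟩
    φ x + δ x + suc (length xs)     ≡⟨ cong (_+ suc (length xs)) (φ-+-δ px) ⟩
    x + suc (length xs)             ≡⟨ cong (_+ suc (length xs)) (largest-linked sorted) ⟨
    largest (x ∷ xs) + length (x ∷ xs) ∎
    where
    open ≡-Reasoning
    length-padded : length (map φ xs ++ replicate (δ x) a₁) ≡ length xs + δ x
    length-padded = trans (length-++ (map φ xs)) (cong₂ _+_ (length-map φ xs) (length-replicate (δ x)))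
    rearrange : ∀ p l k → p + suc (l + k) ≡ p + k + suc l
    rearrange = solve-∀

  shrink-counted : ∀ {n π} → IsCounted d a₂ b₂ n π → IsCounted d a₁ b₁ n (shrink π)
  shrink-counted {π = []} (_ , _ , _ , ())
  shrink-counted {π = x ∷ xs} counted@(sorted , _ , _ , perimeter) =
    allowed⇒counted adm₁ (padded-linked pxs sorted (δ x)) (shrink-allowed pxs)
      (trans (shrink-perimeter pxs sorted) perimeter)
    where pxs = counted⇒allowed adm₂ counted

  shrink-injective : ∀ {π π′} → All (Allowed a₂ b₂) π → All (Allowed a₂ b₂) π′
    → shrink π ≡ shrink π′ → π ≡ π′
  shrink-injective [] [] _ = refl
  shrink-injective (px ∷ pxs) (py ∷ pys) eq with φ-injective px py (∷-injectiveˡ eq)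
  ... | refl =
    cong (_ ∷_) (map-φ-injective pxs pys (++-cancelʳ _ (map φ _) (map φ _) (∷-injectiveʳ eq)))

  extra : Class → ℕ → ℕ → List ℕ
  extra c n j = part a₁ b₁ c (suc j) ∷ replicate (n ∸ part a₁ b₁ c (suc j)) b₁

  extra-counted : ∀ c {n j} → part a₁ b₁ c (suc j) ≤ n → IsCounted d a₁ b₁ n (extra c n j)
  extra-counted c {n} {j} top≤n =
    allowed⇒counted adm₁ sorted (allowed c (suc j) ∷ All.replicate⁺ _ (base-allowed β)) perimeter
    where
    top = part a₁ b₁ c (suc j)
    b₁≤top : b₁ ≤ top
    b₁≤top = ≤-trans (Admissible.b≤d adm₁)
      (≤-trans (m≤m+n d (j * d)) (m≤n+m (suc j * d) (base a₁ b₁ c)))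
    sorted : Linked _≥_ (extra c n j)
    sorted = linked-replicate _ b₁≤top
    perimeter : largest (extra c n j) + length (extra c n j) ≡ suc n
    perimeter = begin
      largest (extra c n j) + length (extra c n j)
        ≡⟨ cong₂ _+_ (largest-linked sorted) (cong suc (length-replicate _)) ⟩
      top + suc (n ∸ top)                          ≡⟨ +-suc top (n ∸ top) ⟩
      suc (top + (n ∸ top))                        ≡⟨ cong suc (m+[n∸m]≡n top≤n) ⟩
      suc n                                        ∎
      where open ≡-Reasoning

  extras-unique : ∀ c n M → Unique (applyUpTo (extra c n) M)
  extras-unique c n M = Unique.applyUpTo⁺₁ (extra c n) M λ {i} {j} i<j _ eq →
    <⇒≢ i<j (suc-injective (proj₂ (part-injective adm₁ {c} {c} {suc i} {suc j} (∷-injectiveˡ eq))))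

  shrink≢extra : ∀ {c n j π} → 0 < shift c → All (Allowed a₂ b₂) π → shrink π ≢ extra c n j
  shrink≢extra {c} {j = j} {π = _ ∷ xs} 0<shift (allowed c′ k ∷ _) eq
    with part-injective adm₁ {c′} {c} {k} {suc j} (trans (sym (φ-part c′ k)) (∷-injectiveˡ eq))
  ... | refl , _ = <⇒≢ (Admissible.a<b adm₁) (∈-replicate⁻ (subst (a₁ ∈_) (∷-injectiveʳ eq) a₁∈padding))
    where
    a₁∈padding : a₁ ∈ map φ xs ++ replicate (δ (part a₂ b₂ c k)) a₁
    a₁∈padding = ∈-++⁺ʳ (map φ xs)
      (subst (λ m → a₁ ∈ replicate m a₁) (sym (δ-part c k)) (∈-replicate⁺ 0<shift))

  ℓ-+-≤ : ∀ {n} (E : List (List ℕ)) → Unique E → All (IsCounted d a₁ b₁ n) E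
    → (∀ {π} → IsCounted d a₂ b₂ n π → shrink π ∉ E) → ℓ d a₂ b₂ n + length E ≤ ℓ d a₁ b₁ n
  ℓ-+-≤ {n} E uE countedE shrink∉E =
    length-filter-+-≤ (isCounted? d a₂ b₂ n) (isCounted? d a₁ b₁ n) shrink (candidates-unique n) uE
      counted⇒∈candidates shrink-counted
      (λ c c′ → shrink-injective (counted⇒allowed adm₂ c) (counted⇒allowed adm₂ c′))
      countedE shrink∉E

  ℓ-monotone : ∀ n → ℓ d a₂ b₂ n ≤ ℓ d a₁ b₁ n
  ℓ-monotone n = ≤-trans (m≤m+n _ 0) (ℓ-+-≤ {n} [] [] [] λ _ ())

  ℓ-gap : ∀ c → 0 < shift c → ∀ M n → part a₁ b₁ c M ≤ n → ℓ d a₂ b₂ n + M ≤ ℓ d a₁ b₁ n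
  ℓ-gap c 0<shift M n bound =
    subst (λ m → ℓ d a₂ b₂ n + m ≤ ℓ d a₁ b₁ n) (length-applyUpTo (extra c n) M)
      (ℓ-+-≤ extras (extras-unique c n M) (All.applyUpTo⁺₁ (extra c n) M extras-counted) shrink∉extras)
    where
    extras = applyUpTo (extra c n) M
    extras-counted : ∀ {j} → j < M → IsCounted d a₁ b₁ n (extra c n j)
    extras-counted {j} j<M =
      extra-counted c {n} {j} (≤-trans (+-monoʳ-≤ (base a₁ b₁ c) (*-monoˡ-≤ d j<M)) bound)
    shrink∉extras : ∀ {π} → IsCounted d a₂ b₂ n π → shrink π ∉ extras
    shrink∉extras counted π∈ =
      let j , _ , eq = ∈-applyUpTo⁻ (extra c n) π∈
      in shrink≢extra {c} {n} {j} 0<shift (counted⇒allowed adm₂ counted) eq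

  shift-positive : ¬ (a₁ ≡ a₂ × b₁ ≡ b₂) → ∃ λ c → 0 < shift c
  shift-positive different with m≤n⇒m<n∨m≡n a₁≤a₂ | m≤n⇒m<n∨m≡n b₁≤b₂
  ... | inj₁ a₁<a₂ | _          = α , m<n⇒0<n∸m a₁<a₂
  ... | inj₂ _     | inj₁ b₁<b₂ = β , m<n⇒0<n∸m b₁<b₂
  ... | inj₂ a₁≡a₂ | inj₂ b₁≡b₂ = contradiction (a₁≡a₂ , b₁≡b₂) different

proposition1p6 : (d : ℕ) → .{{_ : NonZero d}} → (a₁ a₂ b₁ b₂ : ℕ)
    → 0 < a₁ → a₁ < b₁ → b₁ ≤ d
    → 0 < a₂ → a₂ < b₂ → b₂ ≤ d
    → a₁ ≤ a₂ → b₁ ≤ b₂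
    → ¬ (a₁ ≡ a₂ × b₁ ≡ b₂)
    → ((M : ℕ) → ∃ λ N → (n : ℕ) → N ≤ n → ℓ d a₂ b₂ n + M ≤ ℓ d a₁ b₁ n)
      × ((n : ℕ) → 1 ≤ n → ℓ d a₂ b₂ n ≤ ℓ d a₁ b₁ n)
proposition1p6 d a₁ a₂ b₁ b₂ 0<a₁ a₁<b₁ b₁≤d 0<a₂ a₂<b₂ b₂≤d a₁≤a₂ b₁≤b₂ different =
  let c , 0<shift = shift-positive different in
  (λ M → part a₁ b₁ c M , ℓ-gap c 0<shift M) , λ n _ → ℓ-monotone n
  where
  open Residues d using (admissible; part)
  open Shrink d (admissible 0<a₁ a₁<b₁ b₁≤d) (admissible 0<a₂ a₂<b₂ b₂≤d) a₁≤a₂ b₁≤b₂
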